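{- Let $P,Q$ be finite posets with $|P|=p$, $|Q|=q$, let $D_\lambda\in\mathfrak{D}_n$, and $R=P\oplus D_\lambda\oplus Q$. If $p>q+n-4$, then for every linear extension $f$ of $R$ and all integers $1\le i$, $i+1<j<k\le p+n+q$, $(t_iq_{jk})^2(f)$ agrees with $f$ on every element of $D_\lambda$.
   Context: For a finite poset $X$ with $|X|=N$, a linear extension is a bijection $f:X\to\{1,\ldots,N\}$ with $f(a)<f(b)$ whenever $a<_X b$. For $1\le i\le N-1$ the Bender–Knuth involution $t_i$ swaps labels $i$ and $i+1$ if $f^{ -1}(i)$, $f^{ -1}(i+1)$ are incomparable, and does nothing otherwise. Products denote composition, rightmost first. $q_0=\mathrm{id}$, $q_i=t_1(t_2t_1)\cdots(t_it_{i-1}\cdots t_1)$, $q_{jk}=q_{k-1}q_{k-j}q_{k-1}$. $X\oplus Y$: ordinal sum (all of $X$ below all of $Y$); $+$: disjoint union; $C_m$: $m$-element chain. For $n>1$, $\mathfrak{D}_n$ is the set of posets $C_{\lambda_1}+\cdots+C_{\lambda_\ell}$ with $\lambda\vdash n$, $\ell>1$; $\mathfrak{D}_1=\{C_1\}$. -}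

module Defs where

open import Data.Nat as ℕ using (ℕ; zero; suc; _+_; _∸_; _<_; _<?_; _≟_)
open import Data.Fin as Fin using (Fin; toℕ; fromℕ<; splitAt; _↑ˡ_; _↑ʳ_)
open import Data.Bool using (Bool; true; false; if_then_else_; _∧_; not; _∨_)
open import Data.Maybe using (Maybe; just; nothing)
import Data.Maybe as Maybe
open import Data.List using (List; []; _∷_; length)
open import Data.Nat.ListAction using (sum)
open import Data.List.Relation.Unary.All using (All)
open import Data.List.Relation.Unary.Linked using (Linked)
open import Data.Sum using (_⊎_; inj₁; inj₂)
open import Data.Product using (_×_; _,_)
open import Data.Unit using (⊤; tt)
open import Data.Empty using (⊥)
open import Function using (_∘_; id)
open import Function.Definitions using (Bijective)
open import Relation.Binary using (Rel; Decidable; IsStrictPartialOrder)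
open import Relation.Binary.PropositionalEquality using (_≡_)
open import Relation.Nullary using (Dec; yes; no)
open import Relation.Nullary.Decidable using (⌊_⌋; _×-dec_)

record FinPoset (n : ℕ) : Set₁ where
  field
    _≺_     : Rel (Fin n) _
    isSPO   : IsStrictPartialOrder _≡_ _≺_
    _≺?_    : Decidable _≺_

record DecRel (n : ℕ) : Set₁ where
  field
    _≺_  : Rel (Fin n) _
    _≺?_ : Decidable _≺_

toDecRel : ∀ {n} → FinPoset n → DecRel n
toDecRel P = record { _≺_ = FinPoset._≺_ P ; _≺?_ = FinPoset._≺?_ P }

-- Ordinal sum X ⊕ Y on Fin (a + b): the first a elements form X, the
-- last b elements form Y, and all of X lies below all of Y.

⊕Rel : ∀ {a b} → DecRel a → DecRel b → Rel (Fin (a + b)) _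
⊕Rel {a} X Y x y with splitAt a x | splitAt a y
... | inj₁ x′ | inj₁ y′ = DecRel._≺_ X x′ y′
... | inj₂ x′ | inj₂ y′ = DecRel._≺_ Y x′ y′
... | inj₁ _  | inj₂ _  = ⊤
... | inj₂ _  | inj₁ _  = ⊥

⊕Dec : ∀ {a b} (X : DecRel a) (Y : DecRel b) → Decidable (⊕Rel X Y)
⊕Dec {a} X Y x y with splitAt a x | splitAt a y
... | inj₁ x′ | inj₁ y′ = DecRel._≺?_ X x′ y′
... | inj₂ x′ | inj₂ y′ = DecRel._≺?_ Y x′ y′
... | inj₁ _  | inj₂ _  = yes tt
... | inj₂ _  | inj₁ _  = no (λ ())

_⊕_ : ∀ {a b} → DecRel a → DecRel b → DecRel (a + b)
X ⊕ Y = record { _≺_ = ⊕Rel X Y ; _≺?_ = ⊕Dec X Y }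

-- Partitions and the posets D_λ = C_{λ₁} + ⋯ + C_{λ_ℓ} on Fin n.
-- Element k (0-based) lies in the chain determined by the prefix sums
-- of λ; within a chain the order is the numerical one.

IsPartition : ℕ → List ℕ → Set
IsPartition n λs = sum λs ≡ n × All (0 <_) λs × Linked ℕ._≥_ λs

InFrakD : ℕ → List ℕ → Set
InFrakD n λs = IsPartition n λs × (n ≡ 1 ⊎ 1 < length λs)

blockOf : List ℕ → ℕ → ℕ
blockOf []       k = 0
blockOf (a ∷ as) k with k <? a
... | yes _ = 0
... | no  _ = suc (blockOf as (k ∸ a))

chainsRel : (λs : List ℕ) (n : ℕ) → Rel (Fin n) _
chainsRel λs n x y = toℕ x < toℕ y × blockOf λs (toℕ x) ≡ blockOf λs (toℕ y)

chainsDec : (λs : List ℕ) (n : ℕ) → Decidable (chainsRel λs n)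
chainsDec λs n x y = (toℕ x <? toℕ y) ×-dec (blockOf λs (toℕ x) ≟ blockOf λs (toℕ y))

D : (λs : List ℕ) (n : ℕ) → DecRel n
D λs n = record { _≺_ = chainsRel λs n ; _≺?_ = chainsDec λs n }

-- Linear extensions.  Labels {1,…,N} are represented by Fin N, label
-- m+1 ↔ the element of Fin N with toℕ = m.

IsLinExt : ∀ {N} → DecRel N → (Fin N → Fin N) → Set
IsLinExt {N} X f = Bijective _≡_ _≡_ f
                 × (∀ a b → DecRel._≺_ X a b → toℕ (f a) < toℕ (f b))

findFin : ∀ {N} → (Fin N → Bool) → Maybe (Fin N)
findFin {zero}  P = nothing
findFin {suc N} P = if P Fin.zero then just Fin.zero
                    else Maybe.map Fin.suc (findFin (P ∘ Fin.suc))

preimage : ∀ {N} → (Fin N → Fin N) → ℕ → Maybe (Fin N)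
preimage f m = findFin (λ x → ⌊ toℕ (f x) ≟ m ⌋)

labelOr : ∀ {N} → ℕ → Fin N → Fin N
labelOr {N} m ℓ with m <? N
... | yes m<N = fromℕ< m<N
... | no  _   = ℓ

-- transposition of the labels i and i+1 (1-based), i.e. 0-based i∸1 and i
swapLabels : ∀ {N} → ℕ → Fin N → Fin N
swapLabels i ℓ with toℕ ℓ ≟ i ∸ 1 | toℕ ℓ ≟ i
... | yes _ | _     = labelOr i ℓ
... | no  _ | yes _ = labelOr (i ∸ 1) ℓ
... | no  _ | no  _ = ℓ

comparable : ∀ {N} → DecRel N → Fin N → Fin N → Bool
comparable X u v = ⌊ DecRel._≺?_ X u v ⌋ ∨ ⌊ DecRel._≺?_ X v u ⌋

t : ∀ {N} → DecRel N → ℕ → (Fin N → Fin N) → (Fin N → Fin N)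
t X zero    f = f
t X (suc m) f with preimage f m | preimage f (suc m)
... | just u | just v = if comparable X u v then f else swapLabels (suc m) ∘ f
... | _      | _      = f

down : ∀ {N} → DecRel N → ℕ → (Fin N → Fin N) → (Fin N → Fin N)
down X zero    = id
down X (suc i) = t X (suc i) ∘ down X i

-- q_0 = id,  q_i = t_1 (t_2 t_1) ⋯ (t_i ⋯ t_1) = q_{i-1} ∘ (t_i ⋯ t_1)
q : ∀ {N} → DecRel N → ℕ → (Fin N → Fin N) → (Fin N → Fin N)
q X zero    = id
q X (suc i) = q X i ∘ down X (suc i)

qq : ∀ {N} → DecRel N → ℕ → ℕ → (Fin N → Fin N) → (Fin N → Fin N)
qq X j k = q X (k ∸ 1) ∘ q X (k ∸ j) ∘ q X (k ∸ 1)

inD : (p n q : ℕ) → Fin n → Fin (p + n + q)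
inD p n q d = (p ↑ʳ d) ↑ˡ q

-- Write M = D_λ and call a labeling f of R = P ⊕ M ⊕ Q admissible if it is injective and
-- f(P) < f(M) < f(Q); linear extensions are admissible, the t_s preserve admissibility, and M then
-- carries exactly the labels p+1, …, p+n. On admissible labelings the restriction of t_s f to M
-- depends only on the restriction of f to M, because a label of M is never exchanged with a label
-- outside M: those elements are comparable with all of M. Since every t_s is an involution and t_r,
-- t_s commute for |r - s| ≥ 2, each q_m is an involution, hence so is q_jk. If i ≤ p or i ≥ p + n,
-- then t_i fixes M, so (t_i q_jk)² agrees with q_jk² = id on M. Otherwise j ≥ i + 2 ≥ p + 3, and
-- p > q + n - 4 gives k - j ≤ p; then q_{k-j} is a word in t_1, …, t_p, which fix M, so q_jk agrees
-- with q_{k-1}² = id on M, and (t_i q_jk)² agrees with t_i² = id.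

{-# OPTIONS --safe #-}
module Submission where

open import Defs
open import Data.Bool using (Bool; true; false; if_then_else_; not; T)
open import Data.Bool.Properties using (∨-comm; T-≡)
open import Data.Fin as Fin using (Fin; toℕ; fromℕ<; splitAt; _↑ˡ_; _↑ʳ_)
open import Data.Fin.Properties
  using ( toℕ-injective; toℕ-fromℕ<; toℕ<n; splitAt-↑ˡ; splitAt-↑ʳ; injective⇒≤
        ; ↑ˡ-injective; ↑ʳ-injective; any?)
open import Data.List using (List)
open import Data.Maybe using (Maybe; just; nothing)
open import Data.Nat using (ℕ; zero; suc; _+_; _∸_; _<_; _≤_; _<?_; _≤?_; _≟_; z≤n; s≤s)
open import Data.Nat.Properties
open import Data.Product using (Σ-syntax; _×_; _,_; proj₁; proj₂)
open import Data.Sum using (_⊎_; inj₁; inj₂; [_,_]′)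
open import Data.Unit using (tt)
open import Function using (_∘_; _∘′_; id; const)
open import Function.Bundles using (_⇔_; mk⇔; Equivalence)
open import Function.Definitions using (Injective)
open import Level using (Level; 0ℓ)
open import Relation.Binary using (Rel; IsEquivalence; tri<; tri≈; tri>)
open import Relation.Binary.PropositionalEquality
open import Relation.Nullary using (Dec; yes; no; ¬_; contradiction)
open import Relation.Nullary.Decidable
  using (⌊_⌋; _⊎-dec_; _×-dec_; toWitness; fromWitness; isYes≗does; does-⇔)

labelOrℕ : ℕ → ℕ → ℕ → ℕ
labelOrℕ N i x with i <? N
... | yes _ = i
... | no  _ = x

toℕ-labelOr : ∀ {N} i (ℓ : Fin N) → toℕ (labelOr i ℓ) ≡ labelOrℕ N i (toℕ ℓ)
toℕ-labelOr {N} i ℓ with i <? N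
... | yes i<N = toℕ-fromℕ< i<N
... | no  _   = refl

labelOrℕ-< : ∀ {N i} x → i < N → labelOrℕ N i x ≡ i
labelOrℕ-< {N} {i} x i<N with i <? N
... | yes _   = refl
... | no  i≮N = contradiction i<N i≮N

labelOrℕ-≮ : ∀ {N i} x → ¬ i < N → labelOrℕ N i x ≡ x
labelOrℕ-≮ {N} {i} x i≮N with i <? N
... | yes i<N = contradiction i<N i≮N
... | no  _   = refl

_∈⟨_⟩ : ℕ → ℕ → Set
x ∈⟨ m ⟩ = x ≡ m ⊎ x ≡ suc m

_∈⟨_⟩? : ∀ x m → Dec (x ∈⟨ m ⟩)
x ∈⟨ m ⟩? = (x ≟ m) ⊎-dec (x ≟ suc m)

∈⟨⟩-far : ∀ {a b y} → suc (suc b) ≤ a → y ∈⟨ b ⟩ → ¬ y ∈⟨ a ⟩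
∈⟨⟩-far {a} {b} b+2≤a y∈b y∈a = ≤⇒≯ (a≤1+b y∈b y∈a) b+2≤a
  where
  a≤1+b : ∀ {y} → y ∈⟨ b ⟩ → y ∈⟨ a ⟩ → a ≤ suc b
  a≤1+b (inj₁ refl) (inj₁ refl) = n≤1+n _
  a≤1+b (inj₁ refl) (inj₂ refl) = ≤-trans (n≤1+n _) (n≤1+n _)
  a≤1+b (inj₂ refl) (inj₁ refl) = ≤-refl
  a≤1+b (inj₂ refl) (inj₂ refl) = n≤1+n _

-- The action of swapLabels (suc m) on 0-based label values in Fin N; if suc m ≥ N it fixes m.
swapℕ : ℕ → ℕ → ℕ → ℕ
swapℕ N m x with x ≟ m | x ≟ suc m
... | yes _ | _     = labelOrℕ N (suc m) x
... | no  _ | yes _ = labelOrℕ N m x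
... | no  _ | no  _ = x

toℕ-swapLabels : ∀ {N} m (ℓ : Fin N) → toℕ (swapLabels (suc m) ℓ) ≡ swapℕ N m (toℕ ℓ)
toℕ-swapLabels m ℓ with toℕ ℓ ≟ m | toℕ ℓ ≟ suc m
... | yes _ | _     = toℕ-labelOr (suc m) ℓ
... | no  _ | yes _ = toℕ-labelOr m ℓ
... | no  _ | no  _ = refl

swapℕ-at-m : ∀ N m → swapℕ N m m ≡ labelOrℕ N (suc m) m
swapℕ-at-m N m with m ≟ m
... | yes _   = refl
... | no  m≢m = contradiction refl m≢m

swapℕ-at-suc : ∀ N m → swapℕ N m (suc m) ≡ labelOrℕ N m (suc m)
swapℕ-at-suc N m with suc m ≟ m | suc m ≟ suc m
... | yes e | _     = contradiction e (1+n≢n)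
... | no  _ | yes _ = refl
... | no  _ | no  e = contradiction refl e

swapℕ-m : ∀ {N m} → suc m < N → swapℕ N m m ≡ suc m
swapℕ-m {N} {m} m+1<N = trans (swapℕ-at-m N m) (labelOrℕ-< m m+1<N)

swapℕ-suc : ∀ {N m} → suc m < N → swapℕ N m (suc m) ≡ m
swapℕ-suc {N} {m} m+1<N = trans (swapℕ-at-suc N m) (labelOrℕ-< (suc m) (<-trans (n<1+n m) m+1<N))

swapℕ-outside : ∀ N m {x} → ¬ x ∈⟨ m ⟩ → swapℕ N m x ≡ x
swapℕ-outside N m {x} x∉ with x ≟ m | x ≟ suc m
... | yes e | _     = contradiction (inj₁ e) x∉
... | no  _ | yes e = contradiction (inj₂ e) x∉
... | no  _ | no  _ = refl

swapℕ-involutive : ∀ N m {x} → x < N → swapℕ N m (swapℕ N m x) ≡ x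
swapℕ-involutive N m {x} x<N with x ∈⟨ m ⟩?
... | no x∉ = trans (cong (swapℕ N m) (swapℕ-outside N m x∉)) (swapℕ-outside N m x∉)
... | yes (inj₂ refl) = trans (cong (swapℕ N m) (swapℕ-suc x<N)) (swapℕ-m x<N)
... | yes (inj₁ refl) with suc m <? N
...   | yes m+1<N = trans (cong (swapℕ N m) (swapℕ-m m+1<N)) (swapℕ-suc m+1<N)
...   | no  m+1≮N = trans (cong (swapℕ N m) m↦m) m↦m
  where
  m↦m : swapℕ N m m ≡ m
  m↦m = trans (swapℕ-at-m N m) (labelOrℕ-≮ m m+1≮N)

swapℕ-∈ : ∀ N m {x} → x ∈⟨ m ⟩ → swapℕ N m x ∈⟨ m ⟩
swapℕ-∈ N m (inj₁ refl) with suc m <? N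
... | yes m+1<N = inj₂ (trans (swapℕ-at-m N m) (labelOrℕ-< m m+1<N))
... | no  m+1≮N = inj₁ (trans (swapℕ-at-m N m) (labelOrℕ-≮ m m+1≮N))
swapℕ-∈ N m (inj₂ refl) with m <? N
... | yes m<N = inj₁ (trans (swapℕ-at-suc N m) (labelOrℕ-< (suc m) m<N))
... | no  m≮N = inj₂ (trans (swapℕ-at-suc N m) (labelOrℕ-≮ (suc m) m≮N))

swapℕ-comm-far : ∀ N {a b} x → suc (suc b) ≤ a → swapℕ N a (swapℕ N b x) ≡ swapℕ N b (swapℕ N a x)
swapℕ-comm-far N {a} {b} x b+2≤a with x ∈⟨ b ⟩? | x ∈⟨ a ⟩?
... | yes x∈b | _ = begin
  swapℕ N a (swapℕ N b x) ≡⟨ swapℕ-outside N a (∈⟨⟩-far b+2≤a (swapℕ-∈ N b x∈b)) ⟩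
  swapℕ N b x             ≡⟨ cong (swapℕ N b) (swapℕ-outside N a (∈⟨⟩-far b+2≤a x∈b)) ⟨
  swapℕ N b (swapℕ N a x) ∎
  where open ≡-Reasoning
... | no x∉b | yes x∈a = begin
  swapℕ N a (swapℕ N b x) ≡⟨ cong (swapℕ N a) (swapℕ-outside N b x∉b) ⟩
  swapℕ N a x             ≡⟨ swapℕ-outside N b (λ y∈b → ∈⟨⟩-far b+2≤a y∈b (swapℕ-∈ N a x∈a)) ⟨
  swapℕ N b (swapℕ N a x) ∎
  where open ≡-Reasoning
... | no x∉b | no x∉a = begin
  swapℕ N a (swapℕ N b x) ≡⟨ cong (swapℕ N a) (swapℕ-outside N b x∉b) ⟩
  swapℕ N a x             ≡⟨ swapℕ-outside N a x∉a ⟩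
  x                       ≡⟨ swapℕ-outside N b x∉b ⟨
  swapℕ N b x             ≡⟨ cong (swapℕ N b) (swapℕ-outside N a x∉a) ⟨
  swapℕ N b (swapℕ N a x) ∎
  where open ≡-Reasoning

swapℕ-monotone : ∀ {N m a b} → suc m < N → a < b → ¬ (a ≡ m × b ≡ suc m) → swapℕ N m a < swapℕ N m b
swapℕ-monotone {N} {m} {a} {b} m+1<N a<b ¬swapped with a ∈⟨ m ⟩? | b ∈⟨ m ⟩?
... | yes (inj₁ refl) | yes (inj₁ refl) = contradiction a<b (<-irrefl refl)
... | yes (inj₁ refl) | yes (inj₂ refl) = contradiction (refl , refl) ¬swapped
... | yes (inj₂ refl) | yes (inj₁ refl) = contradiction (<-trans a<b (n<1+n m)) (<-irrefl refl)
... | yes (inj₂ refl) | yes (inj₂ refl) = contradiction a<b (<-irrefl refl)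
... | yes (inj₁ refl) | no b∉ =
  subst₂ _<_ (sym (swapℕ-m m+1<N)) (sym (swapℕ-outside N m b∉)) (≤∧≢⇒< a<b (b∉ ∘ inj₂ ∘ sym))
... | yes (inj₂ refl) | no b∉ =
  subst₂ _<_ (sym (swapℕ-suc m+1<N)) (sym (swapℕ-outside N m b∉)) (<-trans (n<1+n m) a<b)
... | no a∉ | yes (inj₁ refl) =
  subst₂ _<_ (sym (swapℕ-outside N m a∉)) (sym (swapℕ-m m+1<N)) (<-trans a<b (n<1+n m))
... | no a∉ | yes (inj₂ refl) =
  subst₂ _<_ (sym (swapℕ-outside N m a∉)) (sym (swapℕ-suc m+1<N)) (≤∧≢⇒< (≤-pred a<b) (a∉ ∘ inj₁))
... | no a∉ | no b∉ = subst₂ _<_ (sym (swapℕ-outside N m a∉)) (sym (swapℕ-outside N m b∉)) a<b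

swapLabels-involutive : ∀ {N} m (ℓ : Fin N) → swapLabels (suc m) (swapLabels (suc m) ℓ) ≡ ℓ
swapLabels-involutive {N} m ℓ = toℕ-injective (begin
  toℕ (swapLabels (suc m) (swapLabels (suc m) ℓ)) ≡⟨ toℕ-swapLabels m (swapLabels (suc m) ℓ) ⟩
  swapℕ N m (toℕ (swapLabels (suc m) ℓ))          ≡⟨ cong (swapℕ N m) (toℕ-swapLabels m ℓ) ⟩
  swapℕ N m (swapℕ N m (toℕ ℓ))                   ≡⟨ swapℕ-involutive N m (toℕ<n ℓ) ⟩
  toℕ ℓ                                           ∎)
  where open ≡-Reasoning

findFin-sound : ∀ {N} (P : Fin N → Bool) {x} → findFin P ≡ just x → T (P x)
findFin-sound {suc N} P eq with P Fin.zero in P0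
findFin-sound {suc N} P refl | true = Equivalence.from T-≡ P0
... | false with findFin (P ∘ Fin.suc) in found
findFin-sound {suc N} P refl | false | just y = findFin-sound (P ∘ Fin.suc) found

findFin-complete : ∀ {N} (P : Fin N → Bool) {x} → findFin P ≡ nothing → ¬ T (P x)
findFin-complete {suc N} P eq with P Fin.zero in P0
findFin-complete {suc N} P () | true
... | false with findFin (P ∘ Fin.suc) in found
findFin-complete {suc N} P {Fin.zero} refl | false | nothing = subst T P0
findFin-complete {suc N} P {Fin.suc x} refl | false | nothing = findFin-complete (P ∘ Fin.suc) found

findFin-cong : ∀ {N} {P P′ : Fin N → Bool} → (∀ x → P x ≡ P′ x) → findFin P ≡ findFin P′
findFin-cong {zero} _ = refl
findFin-cong {suc N} {P} {P′} P≗P′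
  rewrite P≗P′ Fin.zero | findFin-cong {P = P ∘ Fin.suc} {P′ ∘ Fin.suc} (P≗P′ ∘ Fin.suc) = refl

preimage-sound : ∀ {N} (f : Fin N → Fin N) {m u} → preimage f m ≡ just u → toℕ (f u) ≡ m
preimage-sound f {m} {u} eq = toWitness {a? = toℕ (f u) ≟ m} (findFin-sound _ eq)

preimage-unique : ∀ {N} {f : Fin N → Fin N} {m u} → Injective _≡_ _≡_ f → toℕ (f u) ≡ m
  → preimage f m ≡ just u
preimage-unique {f = f} {m} {u} f-inj fu≡m with preimage f m in eq
... | just w  = cong just (f-inj (toℕ-injective (trans (preimage-sound f eq) (sym fu≡m))))
... | nothing = contradiction (fromWitness fu≡m) (findFin-complete _ eq)

preimage-cong : ∀ {N} {f g : Fin N → Fin N} {m} → (∀ y → toℕ (f y) ≡ m ⇔ toℕ (g y) ≡ m)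
  → preimage f m ≡ preimage g m
preimage-cong {f = f} {g} {m} same = findFin-cong λ y →
  trans (isYes≗does (toℕ (f y) ≟ m))
    (trans (does-⇔ (same y) (toℕ (f y) ≟ m) (toℕ (g y) ≟ m)) (sym (isYes≗does (toℕ (g y) ≟ m))))

comparable-sym : ∀ {N} (X : DecRel N) u v → comparable X u v ≡ comparable X v u
comparable-sym X u v = ∨-comm ⌊ DecRel._≺?_ X u v ⌋ ⌊ DecRel._≺?_ X v u ⌋

comparable-≺ : ∀ {N} (X : DecRel N) {u v} → DecRel._≺_ X u v → comparable X u v ≡ true
comparable-≺ X {u} {v} u≺v with DecRel._≺?_ X u v
... | yes _   = refl
... | no  u⊀v = contradiction u≺v u⊀v

incomparablePair : ∀ {N} → DecRel N → Maybe (Fin N) → Maybe (Fin N) → Bool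
incomparablePair X (just u) (just v) = not (comparable X u v)
incomparablePair X _        _        = false

swapsAt : ∀ {N} → DecRel N → ℕ → (Fin N → Fin N) → Bool
swapsAt X m f = incomparablePair X (preimage f m) (preimage f (suc m))

select : ∀ {N} → Bool → ℕ → (Fin N → Fin N) → (Fin N → Fin N)
select b m f = if b then swapLabels (suc m) ∘ f else f

t-unfold : ∀ {N} (X : DecRel N) m f → t X (suc m) f ≡ select (swapsAt X m f) m f
t-unfold X m f with preimage f m | preimage f (suc m)
... | just u  | just v with comparable X u v
...   | true  = refl
...   | false = refl
t-unfold X m f | just _  | nothing = refl
t-unfold X m f | nothing | _       = refl

t-no-swap : ∀ {N} (X : DecRel N) m {f} → swapsAt X m f ≡ false → t X (suc m) f ≡ f
t-no-swap X m {f} no-swap = trans (t-unfold X m f) (cong (λ b → select b m f) no-swap)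

t-swap : ∀ {N} (X : DecRel N) m {f} → swapsAt X m f ≡ true → t X (suc m) f ≡ swapLabels (suc m) ∘ f
t-swap X m {f} swap = trans (t-unfold X m f) (cong (λ b → select b m f) swap)

swapsAt-true⇒ : ∀ {N} (X : DecRel N) m {f} → swapsAt X m f ≡ true
  → Σ[ u ∈ Fin N ] Σ[ v ∈ Fin N ] toℕ (f u) ≡ m × toℕ (f v) ≡ suc m × comparable X u v ≡ false
swapsAt-true⇒ X m {f} swap with preimage f m in pu | preimage f (suc m) in pv
... | just u | just v with comparable X u v in c
...   | false = u , v , preimage-sound f pu , preimage-sound f pv , c
swapsAt-true⇒ X m () | just u | just v | true
swapsAt-true⇒ X m () | just _ | nothing
swapsAt-true⇒ X m () | nothing | _

swapsAt-false : ∀ {N} (X : DecRel N) m {f}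
  → (∀ u v → toℕ (f u) ≡ m → toℕ (f v) ≡ suc m → comparable X u v ≡ true) → swapsAt X m f ≡ false
swapsAt-false X m {f} all-comparable with swapsAt X m f in swap
... | false = refl
... | true with swapsAt-true⇒ X m swap
...   | u , v , fu , fv , incomparable with trans (sym (all-comparable u v fu fv)) incomparable
...     | ()

swapsAt-≡ : ∀ {N} (X : DecRel N) m {f u v} → Injective _≡_ _≡_ f
  → toℕ (f u) ≡ m → toℕ (f v) ≡ suc m → swapsAt X m f ≡ not (comparable X u v)
swapsAt-≡ X m f-inj fu fv = cong₂ (incomparablePair X) (preimage-unique f-inj fu) (preimage-unique f-inj fv)

select-injective : ∀ {N} b m {f : Fin N → Fin N} → Injective _≡_ _≡_ f → Injective _≡_ _≡_ (select b m f)
select-injective true m {f} f-inj {x} {y} eq = f-inj (begin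
  f x                                             ≡⟨ swapLabels-involutive m (f x) ⟨
  swapLabels (suc m) (swapLabels (suc m) (f x))   ≡⟨ cong (swapLabels (suc m)) eq ⟩
  swapLabels (suc m) (swapLabels (suc m) (f y))   ≡⟨ swapLabels-involutive m (f y) ⟩
  f y                                             ∎)
  where open ≡-Reasoning
select-injective false m f-inj = f-inj

t-injective : ∀ {N} (X : DecRel N) s {f : Fin N → Fin N} → Injective _≡_ _≡_ f
  → Injective _≡_ _≡_ (t X s f)
t-injective X zero    f-inj = f-inj
t-injective X (suc m) {f} f-inj rewrite t-unfold X m f = select-injective (swapsAt X m f) m f-inj

t-involutive : ∀ {N} (X : DecRel N) s {f : Fin N → Fin N} → Injective _≡_ _≡_ f → ∀ x
  → t X s (t X s f) x ≡ f x
t-involutive X zero    f-inj x = refl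
t-involutive {N} X (suc m) {f} f-inj x with swapsAt X m f in swap
... | false rewrite t-no-swap X m swap | t-no-swap X m swap = refl
... | true with swapsAt-true⇒ X m swap
...   | u , v , fu , fv , incomparable = begin
  t X (suc m) (t X (suc m) f) x                  ≡⟨ cong (λ h → t X (suc m) h x) (t-swap X m swap) ⟩
  t X (suc m) (swapLabels (suc m) ∘ f) x         ≡⟨ cong-app (t-swap X m swaps-back) x ⟩
  swapLabels (suc m) (swapLabels (suc m) (f x))  ≡⟨ swapLabels-involutive m (f x) ⟩
  f x                                            ∎
  where
  open ≡-Reasoning
  m+1<N : suc m < N
  m+1<N = subst (_< N) fv (toℕ<n (f v))
  swaps-back : swapsAt X m (swapLabels (suc m) ∘ f) ≡ true
  swaps-back = begin
    swapsAt X m (swapLabels (suc m) ∘ f)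
      ≡⟨ swapsAt-≡ X m (select-injective true m f-inj)
           (trans (toℕ-swapLabels m (f v)) (trans (cong (swapℕ N m) fv) (swapℕ-suc m+1<N)))
           (trans (toℕ-swapLabels m (f u)) (trans (cong (swapℕ N m) fu) (swapℕ-m m+1<N))) ⟩
    not (comparable X v u) ≡⟨ cong not (trans (comparable-sym X v u) incomparable) ⟩
    true                   ∎

t-fixes-outside : ∀ {N} (X : DecRel N) m {f : Fin N → Fin N} {x} → ¬ toℕ (f x) ∈⟨ m ⟩
  → t X (suc m) f x ≡ f x
t-fixes-outside {N} X m {f} {x} fx∉ rewrite t-unfold X m f with swapsAt X m f
... | true  = toℕ-injective (trans (toℕ-swapLabels m (f x)) (swapℕ-outside N m fx∉))
... | false = refl

t-cong-at : ∀ {N} (X : DecRel N) m {f g : Fin N → Fin N} {x}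
  → swapsAt X m f ≡ swapsAt X m g → f x ≡ g x → t X (suc m) f x ≡ t X (suc m) g x
t-cong-at X m {f} {g} same fx≡gx rewrite t-unfold X m f | t-unfold X m g | same with swapsAt X m g
... | true  = cong (swapLabels (suc m)) fx≡gx
... | false = fx≡gx

preimage-select-far : ∀ {N} B b {f : Fin N → Fin N} {c} → ¬ c ∈⟨ b ⟩
  → preimage (select B b f) c ≡ preimage f c
preimage-select-far false b c∉ = refl
preimage-select-far {N} true b {f} {c} c∉ = preimage-cong λ y → mk⇔ (to y) (from y)
  where
  to : ∀ y → toℕ (swapLabels (suc b) (f y)) ≡ c → toℕ (f y) ≡ c
  to y eq with toℕ (f y) ∈⟨ b ⟩?
  ... | yes fy∈ =
    contradiction (subst (_∈⟨ b ⟩) (trans (sym (toℕ-swapLabels b (f y))) eq) (swapℕ-∈ N b fy∈)) c∉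
  ... | no  fy∉ = trans (sym (swapℕ-outside N b fy∉)) (trans (sym (toℕ-swapLabels b (f y))) eq)
  from : ∀ y → toℕ (f y) ≡ c → toℕ (swapLabels (suc b) (f y)) ≡ c
  from y refl = trans (toℕ-swapLabels b (f y)) (swapℕ-outside N b c∉)

swapsAt-select-far : ∀ {N} (X : DecRel N) B a b {f : Fin N → Fin N}
  → suc (suc b) ≤ a ⊎ suc (suc a) ≤ b → swapsAt X a (select B b f) ≡ swapsAt X a f
swapsAt-select-far X B a b far =
  cong₂ (incomparablePair X)
    (preimage-select-far B b (apart (inj₁ refl))) (preimage-select-far B b (apart (inj₂ refl)))
  where
  apart : ∀ {c} → c ∈⟨ a ⟩ → ¬ c ∈⟨ b ⟩
  apart c∈a c∈b = [ (λ b+2≤a → ∈⟨⟩-far b+2≤a c∈b c∈a) , (λ a+2≤b → ∈⟨⟩-far a+2≤b c∈a c∈b) ]′ far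

select-comm-far : ∀ {N} A B a b (f : Fin N → Fin N) x → suc (suc b) ≤ a
  → select A a (select B b f) x ≡ select B b (select A a f) x
select-comm-far true true a b f x b+2≤a = toℕ-injective (begin
  toℕ (swapLabels (suc a) (swapLabels (suc b) (f x)))  ≡⟨ toℕ-swapLabels a (swapLabels (suc b) (f x)) ⟩
  swapℕ _ a (toℕ (swapLabels (suc b) (f x)))           ≡⟨ cong (swapℕ _ a) (toℕ-swapLabels b (f x)) ⟩
  swapℕ _ a (swapℕ _ b (toℕ (f x)))                    ≡⟨ swapℕ-comm-far _ (toℕ (f x)) b+2≤a ⟩
  swapℕ _ b (swapℕ _ a (toℕ (f x)))                    ≡⟨ cong (swapℕ _ b) (toℕ-swapLabels a (f x)) ⟨
  swapℕ _ b (toℕ (swapLabels (suc a) (f x)))           ≡⟨ toℕ-swapLabels b (swapLabels (suc a) (f x)) ⟨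
  toℕ (swapLabels (suc b) (swapLabels (suc a) (f x)))  ∎)
  where open ≡-Reasoning
select-comm-far true  false a b f x _ = refl
select-comm-far false true  a b f x _ = refl
select-comm-far false false a b f x _ = refl

t-comm-far : ∀ {N} (X : DecRel N) r s (f : Fin N → Fin N) → suc (suc s) ≤ r → ∀ x
  → t X r (t X s f) x ≡ t X s (t X r f) x
t-comm-far X r       zero    f _   x = refl
t-comm-far X (suc a) (suc b) f b+2≤a x = begin
  t X (suc a) (t X (suc b) f) x                            ≡⟨ cong (λ h → t X (suc a) h x) (t-unfold X b f) ⟩
  t X (suc a) (select Sb b f) x                            ≡⟨ cong-app (t-unfold X a (select Sb b f)) x ⟩
  select (swapsAt X a (select Sb b f)) a (select Sb b f) x ≡⟨ cong (λ B → select B a (select Sb b f) x)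
                                                                 (swapsAt-select-far X Sb a b (inj₁ b+2≤a′)) ⟩
  select Sa a (select Sb b f) x                            ≡⟨ select-comm-far Sa Sb a b f x b+2≤a′ ⟩
  select Sb b (select Sa a f) x                            ≡⟨ cong (λ B → select B b (select Sa a f) x)
                                                                 (swapsAt-select-far X Sa b a (inj₂ b+2≤a′)) ⟨
  select (swapsAt X b (select Sa a f)) b (select Sa a f) x ≡⟨ cong-app (t-unfold X b (select Sa a f)) x ⟨
  t X (suc b) (select Sa a f) x                            ≡⟨ cong (λ h → t X (suc b) h x) (t-unfold X a f) ⟨
  t X (suc b) (t X (suc a) f) x                            ∎
  where
  open ≡-Reasoning
  Sa Sb : Bool
  Sa = swapsAt X a f
  Sb = swapsAt X b f
  b+2≤a′ : suc (suc b) ≤ a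
  b+2≤a′ = ≤-pred b+2≤a

module QInvolution {N : ℕ} {ℓ : Level} (X : DecRel N) (Adm : (Fin N → Fin N) → Set)
  (_≈_ : Rel (Fin N → Fin N) ℓ) (≈-isEquivalence : IsEquivalence _≈_)
  (t-adm : ∀ s {f} → Adm f → Adm (t X s f))
  (t-cong : ∀ s {f g} → Adm f → Adm g → f ≈ g → t X s f ≈ t X s g)
  (t-inv : ∀ s {f} → Adm f → t X s (t X s f) ≈ f)
  (t-comm : ∀ r s {f} → Adm f → suc (suc s) ≤ r → t X r (t X s f) ≈ t X s (t X r f))
  where

  open IsEquivalence ≈-isEquivalence renaming (refl to ≈-refl; sym to ≈-sym; trans to ≈-trans)

  -- up l = t_1 t_2 ⋯ t_l, the inverse of down l = t_l ⋯ t_1.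
  up : ℕ → (Fin N → Fin N) → (Fin N → Fin N)
  up zero    = id
  up (suc l) = up l ∘ t X (suc l)

  down-adm : ∀ l {f} → Adm f → Adm (down X l f)
  down-adm zero    a = a
  down-adm (suc l) a = t-adm (suc l) (down-adm l a)

  up-adm : ∀ l {f} → Adm f → Adm (up l f)
  up-adm zero    a = a
  up-adm (suc l) a = up-adm l (t-adm (suc l) a)

  q-adm : ∀ l {f} → Adm f → Adm (q X l f)
  q-adm zero    a = a
  q-adm (suc l) a = q-adm l (down-adm (suc l) a)

  down-cong : ∀ l {f g} → Adm f → Adm g → f ≈ g → down X l f ≈ down X l g
  down-cong zero    _  _  f≈g = f≈g
  down-cong (suc l) af ag f≈g = t-cong (suc l) (down-adm l af) (down-adm l ag) (down-cong l af ag f≈g)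

  up-cong : ∀ l {f g} → Adm f → Adm g → f ≈ g → up l f ≈ up l g
  up-cong zero    _  _  f≈g = f≈g
  up-cong (suc l) af ag f≈g = up-cong l (t-adm (suc l) af) (t-adm (suc l) ag) (t-cong (suc l) af ag f≈g)

  q-cong : ∀ l {f g} → Adm f → Adm g → f ≈ g → q X l f ≈ q X l g
  q-cong zero    _  _  f≈g = f≈g
  q-cong (suc l) af ag f≈g = q-cong l (down-adm (suc l) af) (down-adm (suc l) ag) (down-cong (suc l) af ag f≈g)

  down-up : ∀ l {f} → Adm f → down X l (up l f) ≈ f
  down-up zero    a = ≈-refl
  down-up (suc l) a = ≈-trans
    (t-cong (suc l) (down-adm l (up-adm l (t-adm (suc l) a))) (t-adm (suc l) a) (down-up l (t-adm (suc l) a)))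
    (t-inv (suc l) a)

  t-comm-down : ∀ l r {f} → Adm f → suc (suc l) ≤ r → t X r (down X l f) ≈ down X l (t X r f)
  t-comm-down zero    r a l+2≤r = ≈-refl
  t-comm-down (suc l) r a l+2≤r = ≈-trans
    (t-comm r (suc l) (down-adm l a) l+2≤r)
    (t-cong (suc l) (t-adm r (down-adm l a)) (down-adm l (t-adm r a)) (t-comm-down l r a (<⇒≤ l+2≤r)))

  t-comm-q : ∀ l r {f} → Adm f → suc (suc l) ≤ r → t X r (q X l f) ≈ q X l (t X r f)
  t-comm-q zero    r a l+2≤r = ≈-refl
  t-comm-q (suc l) r a l+2≤r = ≈-trans
    (t-comm-q l r (down-adm (suc l) a) (<⇒≤ l+2≤r))
    (q-cong l (t-adm r (down-adm (suc l) a)) (down-adm (suc l) (t-adm r a)) (t-comm-down (suc l) r a l+2≤r))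

  q-suc : ∀ m {f} → Adm f → q X (suc m) f ≈ up (suc m) (q X m f)
  q-suc zero    a = ≈-refl
  q-suc (suc m) a = ≈-trans
    (q-suc m (t-adm (suc (suc m)) (down-adm (suc m) a)))
    (up-cong (suc m) (q-adm m (t-adm (suc (suc m)) (down-adm (suc m) a)))
      (t-adm (suc (suc m)) (q-adm (suc m) a))
      (≈-sym (t-comm-q m (suc (suc m)) (down-adm (suc m) a) ≤-refl)))

  q-involutive : ∀ m {f} → Adm f → q X m (q X m f) ≈ f
  q-involutive zero    a = ≈-refl
  q-involutive (suc m) a = ≈-trans
    (q-cong (suc m) (q-adm (suc m) a) (up-adm (suc m) (q-adm m a)) (q-suc m a))
    (≈-trans
      (q-cong m (down-adm (suc m) (up-adm (suc m) (q-adm m a))) (q-adm m a) (down-up (suc m) (q-adm m a)))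
      (q-involutive m a))

  qq-adm : ∀ j k {f} → Adm f → Adm (qq X j k f)
  qq-adm j k a = q-adm (k ∸ 1) (q-adm (k ∸ j) (q-adm (k ∸ 1) a))

  qq-cong : ∀ j k {f g} → Adm f → Adm g → f ≈ g → qq X j k f ≈ qq X j k g
  qq-cong j k af ag f≈g =
    q-cong (k ∸ 1) (q-adm (k ∸ j) (q-adm (k ∸ 1) af)) (q-adm (k ∸ j) (q-adm (k ∸ 1) ag))
      (q-cong (k ∸ j) (q-adm (k ∸ 1) af) (q-adm (k ∸ 1) ag) (q-cong (k ∸ 1) af ag f≈g))

  qq-involutive : ∀ j k {f} → Adm f → qq X j k (qq X j k f) ≈ f
  qq-involutive j k {f} a = ≈-trans
    (q-cong a′ (q-adm b (q-adm a′ (q-adm a′ y-adm))) (q-adm b y-adm)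
      (q-cong b (q-adm a′ (q-adm a′ y-adm)) y-adm (q-involutive a′ y-adm)))
    (≈-trans (q-cong a′ (q-adm b y-adm) (q-adm a′ a) (q-involutive b (q-adm a′ a))) (q-involutive a′ a))
    where
    a′ b : ℕ
    a′ = k ∸ 1
    b  = k ∸ j
    y-adm : Adm (q X b (q X a′ f))
    y-adm = q-adm b (q-adm a′ a)

  tqq²≈id-if-t≈id : ∀ i j k → (∀ {g} → Adm g → t X i g ≈ g)
    → ∀ {f} → Adm f → t X i (qq X j k (t X i (qq X j k f))) ≈ f
  tqq²≈id-if-t≈id i j k t≈id {f} a = ≈-trans
    (t≈id (qq-adm j k y-adm))
    (≈-trans (qq-cong j k y-adm (qq-adm j k a) (t≈id (qq-adm j k a))) (qq-involutive j k a))
    where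
    y-adm : Adm (t X i (qq X j k f))
    y-adm = t-adm i (qq-adm j k a)

  tqq²≈id-if-qq≈id : ∀ i j k → (∀ {g} → Adm g → qq X j k g ≈ g)
    → ∀ {f} → Adm f → t X i (qq X j k (t X i (qq X j k f))) ≈ f
  tqq²≈id-if-qq≈id i j k qq≈id {f} a = ≈-trans
    (t-cong i (qq-adm j k y-adm) y-adm (qq≈id y-adm))
    (≈-trans (t-inv i (qq-adm j k a)) (qq≈id a))
    where
    y-adm : Adm (t X i (qq X j k f))
    y-adm = t-adm i (qq-adm j k a)

injective-below : ∀ {a N b} (g : Fin a → Fin N) → Injective _≡_ _≡_ g → (∀ y → toℕ (g y) < b) → a ≤ b
injective-below g g-inj g<b = injective⇒≤ {f = λ y → fromℕ< (g<b y)} λ {y} {y′} eq →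
  g-inj (toℕ-injective (trans (sym (toℕ-fromℕ< (g<b y))) (trans (cong toℕ eq) (toℕ-fromℕ< (g<b y′)))))

injective-above : ∀ {a N b} (g : Fin a → Fin N) → Injective _≡_ _≡_ g → (∀ y → b ≤ toℕ (g y)) → a ≤ N ∸ b
injective-above {a} {N} {b} g g-inj b≤g = injective⇒≤ {f = shifted} shifted-injective
  where
  shifted : Fin a → Fin (N ∸ b)
  shifted y = fromℕ< (∸-monoˡ-< (toℕ<n (g y)) (b≤g y))
  toℕ-g : ∀ y → toℕ (g y) ≡ toℕ (shifted y) + b
  toℕ-g y = trans (sym (m∸n+n≡m (b≤g y))) (cong (_+ b) (sym (toℕ-fromℕ< _)))
  shifted-injective : Injective _≡_ _≡_ shifted
  shifted-injective {y} {y′} eq =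
    g-inj (toℕ-injective (trans (toℕ-g y) (trans (cong (λ z → toℕ z + b) eq) (sym (toℕ-g y′)))))

k∸j≤p : ∀ {p n q i j k} → p < i → i + 1 < j → k ≤ p + n + q → q + n < p + 4 → k ∸ j ≤ p
k∸j≤p {p} {n} {q} {i} {j} {k} p<i i+1<j k≤N q+n<p+4 = begin
  k ∸ j                   ≤⟨ ∸-mono k≤N p+3≤j ⟩
  (p + n + q) ∸ (p + 3)   ≤⟨ ∸-monoˡ-≤ (p + 3) N≤p+p+3 ⟩
  (p + (p + 3)) ∸ (p + 3) ≡⟨ m+n∸n≡m p (p + 3) ⟩
  p                       ∎
  where
  open ≤-Reasoning
  p+3≤j : p + 3 ≤ j
  p+3≤j = begin
    p + 3             ≡⟨ +-comm p 3 ⟩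
    suc (suc (suc p)) ≤⟨ s≤s (s≤s p<i) ⟩
    suc (suc i)       ≡⟨ cong suc (+-comm 1 i) ⟩
    suc (i + 1)       ≤⟨ i+1<j ⟩
    j                 ∎
  n+q≤p+3 : n + q ≤ p + 3
  n+q≤p+3 = ≤-pred (begin
    suc (n + q)   ≡⟨ cong suc (+-comm n q) ⟩
    suc (q + n)   ≤⟨ q+n<p+4 ⟩
    p + 4         ≡⟨ +-suc p 3 ⟩
    suc (p + 3)   ∎)
  N≤p+p+3 : p + n + q ≤ p + (p + 3)
  N≤p+p+3 = begin
    p + n + q     ≡⟨ +-assoc p n q ⟩
    p + (n + q)   ≤⟨ +-monoʳ-≤ p n+q≤p+3 ⟩
    p + (p + 3)   ∎

module OrdinalSum {p n q : ℕ} (P : DecRel p) (M : DecRel n) (Q : DecRel q) where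

  R : DecRel (p + n + q)
  R = (P ⊕ M) ⊕ Q

  layer : Fin (p + n + q) → ℕ
  layer x = [ [ const 0 , const 1 ]′ ∘ splitAt p , const 2 ]′ (splitAt (p + n) x)

  layer-<⇒≺ : ∀ x y → layer x < layer y → DecRel._≺_ R x y
  layer-<⇒≺ x y lx<ly with splitAt (p + n) x | splitAt (p + n) y
  ... | inj₁ x′ | inj₁ y′ with splitAt p x′ | splitAt p y′
  ...   | inj₁ _ | inj₂ _ = tt
  layer-<⇒≺ x y ()             | inj₁ _ | inj₁ _ | inj₁ _ | inj₁ _
  layer-<⇒≺ x y ()             | inj₁ _ | inj₁ _ | inj₂ _ | inj₁ _
  layer-<⇒≺ x y (s≤s ())       | inj₁ _ | inj₁ _ | inj₂ _ | inj₂ _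
  layer-<⇒≺ x y _              | inj₁ _ | inj₂ _ = tt
  layer-<⇒≺ x y lx<ly          | inj₂ _ | inj₁ y′ with splitAt p y′
  layer-<⇒≺ x y ()             | inj₂ _ | inj₁ _ | inj₁ _
  layer-<⇒≺ x y (s≤s ())       | inj₂ _ | inj₁ _ | inj₂ _
  layer-<⇒≺ x y (s≤s (s≤s ())) | inj₂ _ | inj₂ _

  comparable-middle-outside : ∀ {x v} → layer x ≡ 1 → layer v ≢ 1 → comparable R x v ≡ true
  comparable-middle-outside {x} {v} x∈M v∉M with <-cmp (layer v) 1
  ... | tri< v<1 _ _ =
    trans (comparable-sym R x v) (comparable-≺ R (layer-<⇒≺ v x (subst (layer v <_) (sym x∈M) v<1)))
  ... | tri≈ _ v≡1 _ = contradiction v≡1 v∉M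
  ... | tri> _ _ 1<v = comparable-≺ R (layer-<⇒≺ x v (subst (_< layer v) (sym x∈M) 1<v))

  inP : Fin p → Fin (p + n + q)
  inP y = (y ↑ˡ n) ↑ˡ q

  inQ : Fin q → Fin (p + n + q)
  inQ z = (p + n) ↑ʳ z

  layer-inP : ∀ y → layer (inP y) ≡ 0
  layer-inP y rewrite splitAt-↑ˡ (p + n) (y ↑ˡ n) q | splitAt-↑ˡ p y n = refl

  layer-inD : ∀ d → layer (inD p n q d) ≡ 1
  layer-inD d rewrite splitAt-↑ˡ (p + n) (p ↑ʳ d) q | splitAt-↑ʳ p n d = refl

  layer-inQ : ∀ z → layer (inQ z) ≡ 2
  layer-inQ z rewrite splitAt-↑ʳ (p + n) q z = refl

  LayerMonotone : (Fin (p + n + q) → Fin (p + n + q)) → Set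
  LayerMonotone f = ∀ x y → layer x < layer y → toℕ (f x) < toℕ (f y)

  Admissible : (Fin (p + n + q) → Fin (p + n + q)) → Set
  Admissible f = Injective _≡_ _≡_ f × LayerMonotone f

  linExt⇒admissible : ∀ {f} → IsLinExt R f → Admissible f
  linExt⇒admissible ((f-inj , _) , f-mono) = f-inj , λ x y lx<ly → f-mono x y (layer-<⇒≺ x y lx<ly)

  middle-labels : ∀ {f} → Admissible f → ∀ {x} → layer x ≡ 1 → p ≤ toℕ (f x) × toℕ (f x) < p + n
  middle-labels {f} (f-inj , f-mono) {x} x∈M = p≤fx , fx<p+n
    where
    p≤fx : p ≤ toℕ (f x)
    p≤fx = injective-below (f ∘ inP) (λ eq → ↑ˡ-injective n _ _ (↑ˡ-injective q _ _ (f-inj eq)))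
      (λ y → f-mono (inP y) x (subst₂ _<_ (sym (layer-inP y)) (sym x∈M) (s≤s z≤n)))
    q≤N∸fx+1 : q ≤ p + n + q ∸ suc (toℕ (f x))
    q≤N∸fx+1 = injective-above (f ∘ inQ) (λ eq → ↑ʳ-injective (p + n) _ _ (f-inj eq))
      (λ z → f-mono x (inQ z) (subst₂ _<_ (sym x∈M) (sym (layer-inQ z)) (s≤s (s≤s z≤n))))
    fx<p+n : toℕ (f x) < p + n
    fx<p+n = +-cancelʳ-≤ q (suc (toℕ (f x))) (p + n)
      (subst (_≤ p + n + q) (+-comm q (suc (toℕ (f x)))) (m≤o∸n⇒m+n≤o q (toℕ<n (f x)) q≤N∸fx+1))

  t-monotone : ∀ s {f} → Admissible f → LayerMonotone (t R s f)
  t-monotone zero    (_ , f-mono) = f-mono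
  t-monotone (suc m) {f} (f-inj , f-mono) x y lx<ly with swapsAt R m f in swap
  ... | false rewrite t-no-swap R m swap = f-mono x y lx<ly
  ... | true with swapsAt-true⇒ R m swap
  ...   | u , v , fu , fv , incomparable rewrite t-swap R m swap =
    subst₂ _<_ (sym (toℕ-swapLabels m (f x))) (sym (toℕ-swapLabels m (f y)))
      (swapℕ-monotone (subst (_< p + n + q) fv (toℕ<n (f v))) (f-mono x y lx<ly) not-the-pair)
    where
    not-the-pair : ¬ (toℕ (f x) ≡ m × toℕ (f y) ≡ suc m)
    not-the-pair (fx≡m , fy≡m+1)
      with f-inj (toℕ-injective (trans fx≡m (sym fu))) | f-inj (toℕ-injective (trans fy≡m+1 (sym fv)))
    ... | refl | refl with trans (sym (comparable-≺ R (layer-<⇒≺ x y lx<ly))) incomparable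
    ...   | ()

  t-admissible : ∀ s {f} → Admissible f → Admissible (t R s f)
  t-admissible s a = t-injective R s (proj₁ a) , t-monotone s a

  _≈ᴹ_ : Rel (Fin (p + n + q) → Fin (p + n + q)) 0ℓ
  f ≈ᴹ g = ∀ x → layer x ≡ 1 → f x ≡ g x

  ≈ᴹ-isEquivalence : IsEquivalence _≈ᴹ_
  ≈ᴹ-isEquivalence = record
    { refl  = λ _ _ → refl
    ; sym   = λ f≈g x x∈M → sym (f≈g x x∈M)
    ; trans = λ f≈g g≈h x x∈M → trans (f≈g x x∈M) (g≈h x x∈M)
    }

  t-fixes-if-partner-above-outside : ∀ m {f} → Injective _≡_ _≡_ f → ∀ {x} → layer x ≡ 1 → toℕ (f x) ≡ m
    → (∀ v → layer v ≡ 1 → toℕ (f v) ≢ suc m) → t R (suc m) f x ≡ f x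
  t-fixes-if-partner-above-outside m {f} f-inj {x} x∈M fx≡m outside =
    cong-app (t-no-swap R m (swapsAt-false R m comparable-pair)) x
    where
    comparable-pair : ∀ u v → toℕ (f u) ≡ m → toℕ (f v) ≡ suc m → comparable R u v ≡ true
    comparable-pair u v fu fv with f-inj (toℕ-injective (trans fu (sym fx≡m)))
    ... | refl = comparable-middle-outside x∈M (λ v∈M → outside v v∈M fv)

  t-fixes-if-partner-below-outside : ∀ m {f} → Injective _≡_ _≡_ f → ∀ {x} → layer x ≡ 1
    → toℕ (f x) ≡ suc m
    → (∀ u → layer u ≡ 1 → toℕ (f u) ≢ m) → t R (suc m) f x ≡ f x
  t-fixes-if-partner-below-outside m {f} f-inj {x} x∈M fx≡m+1 outside =
    cong-app (t-no-swap R m (swapsAt-false R m comparable-pair)) x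
    where
    comparable-pair : ∀ u v → toℕ (f u) ≡ m → toℕ (f v) ≡ suc m → comparable R u v ≡ true
    comparable-pair u v fu fv with f-inj (toℕ-injective (trans fv (sym fx≡m+1)))
    ... | refl = trans (comparable-sym R u x) (comparable-middle-outside x∈M (λ u∈M → outside u u∈M fu))

  ≈ᴹ-label : ∀ {f g} → f ≈ᴹ g → ∀ {y c} → layer y ≡ 1 → toℕ (f y) ≡ c → toℕ (g y) ≡ c
  ≈ᴹ-label f≈g {y} y∈M fy≡c = trans (cong toℕ (sym (f≈g y y∈M))) fy≡c

  -- Swapping a label of M with a label outside M never happens, as every element outside M is
  -- comparable with all of M; so t_s only looks at the labels that M carries.
  t-local-at-lower : ∀ m {f g} → Injective _≡_ _≡_ f → Injective _≡_ _≡_ g → f ≈ᴹ g → ∀ {x} → layer x ≡ 1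
    → toℕ (f x) ≡ m → t R (suc m) f x ≡ t R (suc m) g x
  t-local-at-lower m {f} {g} f-inj g-inj f≈g {x} x∈M fx≡m
    with any? (λ v → (layer v ≟ 1) ×-dec (toℕ (f v) ≟ suc m))
  ... | yes (v , v∈M , fv≡m+1) = t-cong-at R m same-swap (f≈g x x∈M)
    where
    same-swap : swapsAt R m f ≡ swapsAt R m g
    same-swap = trans (swapsAt-≡ R m f-inj fx≡m fv≡m+1)
      (sym (swapsAt-≡ R m g-inj (≈ᴹ-label f≈g x∈M fx≡m) (≈ᴹ-label f≈g v∈M fv≡m+1)))
  ... | no none = begin
    t R (suc m) f x ≡⟨ t-fixes-if-partner-above-outside m f-inj x∈M fx≡m
                         (λ v v∈M fv → none (v , v∈M , fv)) ⟩
    f x             ≡⟨ f≈g x x∈M ⟩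
    g x             ≡⟨ t-fixes-if-partner-above-outside m g-inj x∈M (≈ᴹ-label f≈g x∈M fx≡m)
                         (λ v v∈M gv → none (v , v∈M , trans (cong toℕ (f≈g v v∈M)) gv)) ⟨
    t R (suc m) g x ∎
    where open ≡-Reasoning

  t-local-at-upper : ∀ m {f g} → Injective _≡_ _≡_ f → Injective _≡_ _≡_ g → f ≈ᴹ g → ∀ {x} → layer x ≡ 1
    → toℕ (f x) ≡ suc m → t R (suc m) f x ≡ t R (suc m) g x
  t-local-at-upper m {f} {g} f-inj g-inj f≈g {x} x∈M fx≡m+1
    with any? (λ u → (layer u ≟ 1) ×-dec (toℕ (f u) ≟ m))
  ... | yes (u , u∈M , fu≡m) = t-cong-at R m same-swap (f≈g x x∈M)
    where
    same-swap : swapsAt R m f ≡ swapsAt R m g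
    same-swap = trans (swapsAt-≡ R m f-inj fu≡m fx≡m+1)
      (sym (swapsAt-≡ R m g-inj (≈ᴹ-label f≈g u∈M fu≡m) (≈ᴹ-label f≈g x∈M fx≡m+1)))
  ... | no none = begin
    t R (suc m) f x ≡⟨ t-fixes-if-partner-below-outside m f-inj x∈M fx≡m+1
                         (λ u u∈M fu → none (u , u∈M , fu)) ⟩
    f x             ≡⟨ f≈g x x∈M ⟩
    g x             ≡⟨ t-fixes-if-partner-below-outside m g-inj x∈M (≈ᴹ-label f≈g x∈M fx≡m+1)
                         (λ u u∈M gu → none (u , u∈M , trans (cong toℕ (f≈g u u∈M)) gu)) ⟨
    t R (suc m) g x ∎
    where open ≡-Reasoning

  t-local : ∀ s {f g} → Admissible f → Admissible g → f ≈ᴹ g → t R s f ≈ᴹ t R s g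
  t-local zero    _  _  f≈g = f≈g
  t-local (suc m) {f} {g} af ag f≈g x x∈M with toℕ (f x) ∈⟨ m ⟩?
  ... | yes (inj₁ fx≡m)   = t-local-at-lower m (proj₁ af) (proj₁ ag) f≈g x∈M fx≡m
  ... | yes (inj₂ fx≡m+1) = t-local-at-upper m (proj₁ af) (proj₁ ag) f≈g x∈M fx≡m+1
  ... | no  fx∉ = begin
    t R (suc m) f x ≡⟨ t-fixes-outside R m fx∉ ⟩
    f x             ≡⟨ f≈g x x∈M ⟩
    g x             ≡⟨ t-fixes-outside R m (fx∉ ∘ subst (_∈⟨ m ⟩) (cong toℕ (sym (f≈g x x∈M)))) ⟨
    t R (suc m) g x ∎
    where open ≡-Reasoning

  t-fixes-middle : ∀ m → suc m ≤ p ⊎ p + n ≤ suc m → ∀ {f} → Admissible f → t R (suc m) f ≈ᴹ f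
  t-fixes-middle m window {f} a@(f-inj , _) x x∈M with toℕ (f x) ∈⟨ m ⟩? | window
  ... | no fx∉ | _ = t-fixes-outside R m fx∉
  ... | yes (inj₁ fx≡m) | inj₁ m<p =
    contradiction (subst (p ≤_) fx≡m (proj₁ (middle-labels a x∈M))) (<⇒≱ m<p)
  ... | yes (inj₁ fx≡m) | inj₂ p+n≤m+1 = t-fixes-if-partner-above-outside m f-inj x∈M fx≡m
    λ v v∈M fv≡m+1 → <⇒≱ (proj₂ (middle-labels a v∈M)) (subst (p + n ≤_) (sym fv≡m+1) p+n≤m+1)
  ... | yes (inj₂ fx≡m+1) | inj₂ p+n≤m+1 =
    contradiction (subst (p + n ≤_) (sym fx≡m+1) p+n≤m+1) (<⇒≱ (proj₂ (middle-labels a x∈M)))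
  ... | yes (inj₂ fx≡m+1) | inj₁ m<p = t-fixes-if-partner-below-outside m f-inj x∈M fx≡m+1
    λ u u∈M fu≡m → <⇒≱ m<p (subst (p ≤_) fu≡m (proj₁ (middle-labels a u∈M)))

  open QInvolution R Admissible _≈ᴹ_ ≈ᴹ-isEquivalence t-admissible t-local
    (λ s a x _ → t-involutive R s (proj₁ a) x)
    (λ r s {f} _ s+2≤r x _ → t-comm-far R r s f s+2≤r x)

  down-fixes-middle : ∀ l → l ≤ p → ∀ {f} → Admissible f → down R l f ≈ᴹ f
  down-fixes-middle zero    _   _ = λ _ _ → refl
  down-fixes-middle (suc l) l<p a x x∈M = trans
    (t-fixes-middle l (inj₁ l<p) (down-adm l a) x x∈M)
    (down-fixes-middle l (<⇒≤ l<p) a x x∈M)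

  q-fixes-middle : ∀ l → l ≤ p → ∀ {f} → Admissible f → Defs.q R l f ≈ᴹ f
  q-fixes-middle zero    _   _ = λ _ _ → refl
  q-fixes-middle (suc l) l<p a x x∈M = trans
    (q-fixes-middle l (<⇒≤ l<p) (down-adm (suc l) a) x x∈M)
    (down-fixes-middle (suc l) l<p a x x∈M)

  qq-fixes-middle : ∀ j k → k ∸ j ≤ p → ∀ {f} → Admissible f → qq R j k f ≈ᴹ f
  qq-fixes-middle j k k∸j≤p a x x∈M = trans
    (q-cong (k ∸ 1) (q-adm (k ∸ j) (q-adm (k ∸ 1) a)) (q-adm (k ∸ 1) a)
      (q-fixes-middle (k ∸ j) k∸j≤p (q-adm (k ∸ 1) a)) x x∈M)
    (q-involutive (k ∸ 1) a x x∈M)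

  tqq²-fixes-middle : ∀ {i j k} → q + n < p + 4 → i + 1 < j → k ≤ p + n + q
    → ∀ {f} → Admissible f → t R i (qq R j k (t R i (qq R j k f))) ≈ᴹ f
  tqq²-fixes-middle {zero} {j} {k} _ _ _ = tqq²≈id-if-t≈id zero j k (λ _ _ _ → refl)
  tqq²-fixes-middle {suc m} {j} {k} q+n<p+4 i+1<j k≤N with suc m ≤? p | p + n ≤? suc m
  ... | yes m<p | _ = tqq²≈id-if-t≈id (suc m) j k (t-fixes-middle m (inj₁ m<p))
  ... | no  _   | yes p+n≤m+1 = tqq²≈id-if-t≈id (suc m) j k (t-fixes-middle m (inj₂ p+n≤m+1))
  ... | no  m≮p | no  _ =
    tqq²≈id-if-qq≈id (suc m) j k (qq-fixes-middle j k (k∸j≤p (≰⇒> m≮p) i+1<j k≤N q+n<p+4))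

corollary4p9 : (p q n : ℕ) (P : FinPoset p) (Q : FinPoset q) (λs : List ℕ)
    → InFrakD n λs
    → q + n < p + 4
    → let R = (toDecRel P ⊕ D λs n) ⊕ toDecRel Q in
      (f : Fin (p + n + q) → Fin (p + n + q)) → IsLinExt R f
    → (i j k : ℕ) → 1 ≤ i → i + 1 < j → j < k → k ≤ p + n + q
    → (d : Fin n)
    → (t R i ∘′ qq R j k ∘′ t R i ∘′ qq R j k) f (inD p n q d) ≡ f (inD p n q d)
corollary4p9 p q n P Q λs _ q+n<p+4 f f-linExt i j k _ i+1<j _ k≤N d =
  tqq²-fixes-middle q+n<p+4 i+1<j k≤N (linExt⇒admissible f-linExt) (inD p n q d) (layer-inD d)
  where open OrdinalSum (toDecRel P) (D λs n) (toDecRel Q)
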